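{- Let $c>0$ and let $T$ be a $c$-log-splitting full binary tree with $n$ leaves, of which $k$ are marked, where $k>0$, and in which each internal node is marked if and only if it lies on a path from the root to a marked leaf. Then $T$ has at most $c\cdot(k+1)\cdot\log\frac{n}{k}+2k$ marked nodes.
   Context: In a finite full binary tree the leaves are ordered left to right. A subtree of $T$ is a node of $T$ together with all its descendants. A slice of $T$ is a sequence of pairwise disjoint subtrees of $T$, no two of which are rooted at sibling nodes, whose leaves together form a set of consecutive leaves of $T$. $T$ is $c$-log-splitting if every slice of $T$ whose subtrees contain $j$ leaves in total consists of at most $c\cdot\log(j+1)$ subtrees. $\log$ is base $2$.
   Formalization: The constant $c$ in the log-splitting condition and in the bound ranges over the positive rationals. -}

module Defs where

open import Data.Bool using (Bool; true; false; if_then_else_; _∨_)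
open import Data.Nat using (ℕ; zero; suc; _+_; _*_; _∸_; _^_; _≤_; _<_)
open import Data.List using (List; length; map)
open import Data.Nat.ListAction using (sum)
open import Data.List.Relation.Unary.Any using (Any)
open import Data.List.Relation.Unary.AllPairs using (AllPairs)
open import Data.Product using (_×_)
open import Data.Unit using (⊤)
open import Data.Empty using (⊥)
open import Relation.Nullary using (¬_)

-- Internal nodes are marked iff they lie on a root-to-marked-leaf path,
-- i.e. iff their subtree contains a marked leaf (see markedNodes).
data Tree : Set where
  leaf : Bool → Tree
  node : Tree → Tree → Tree

leaves : Tree → ℕ
leaves (leaf _)   = 1
leaves (node l r) = leaves l + leaves r

hasMark : Tree → Bool
hasMark (leaf b)   = b
hasMark (node l r) = hasMark l ∨ hasMark r

markedLeaves : Tree → ℕ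
markedLeaves (leaf b)   = if b then 1 else 0
markedLeaves (node l r) = markedLeaves l + markedLeaves r

markedNodes : Tree → ℕ
markedNodes (leaf b)   = if b then 1 else 0
markedNodes (node l r) =
  (if hasMark (node l r) then 1 else 0) + markedNodes l + markedNodes r

-- A position of a node in T; a subtree of T is identified with its root position.
data Pos : Tree → Set where
  here  : ∀ {t} → Pos t
  left  : ∀ {l r} → Pos l → Pos (node l r)
  right : ∀ {l r} → Pos r → Pos (node l r)

subtreeAt : ∀ {t} → Pos t → Tree
subtreeAt {t} here = t
subtreeAt (left p)  = subtreeAt p
subtreeAt (right p) = subtreeAt p

size : ∀ {t} → Pos t → ℕ
size p = leaves (subtreeAt p)

-- index (0-based, left to right) of the leftmost leaf of the subtree at p
start : ∀ {t} → Pos t → ℕ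
start here = 0
start (left p) = start p
start (right {l} p) = leaves l + start p

LeafOf : ∀ {t} → Pos t → ℕ → Set
LeafOf p i = start p ≤ i × i < start p + size p

Disjoint : ∀ {t} → Pos t → Pos t → Set
Disjoint here _ = ⊥
Disjoint (left _) here = ⊥
Disjoint (right _) here = ⊥
Disjoint (left p) (left q) = Disjoint p q
Disjoint (left p) (right q) = ⊤
Disjoint (right p) (left q) = ⊤
Disjoint (right p) (right q) = Disjoint p q

Siblings : ∀ {t} → Pos t → Pos t → Set
Siblings (left here) (right here) = ⊤
Siblings (right here) (left here) = ⊤
Siblings (left p) (left q) = Siblings p q
Siblings (right p) (right q) = Siblings p q
Siblings _ _ = ⊥

InSlice : ∀ {t} → List (Pos t) → ℕ → Set
InSlice S i = Any (λ p → LeafOf p i) S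

IsSlice : ∀ {t} → List (Pos t) → Set
IsSlice S =
  AllPairs (λ p q → Disjoint p q × ¬ Siblings p q) S
  × (∀ x y z → x ≤ y → y ≤ z → InSlice S x → InSlice S z → InSlice S y)

sliceLeaves : ∀ {t} → List (Pos t) → ℕ
sliceLeaves S = sum (map size S)

-- T is (a/b)-log-splitting: every slice S with j leaves has
-- |S| ≤ (a/b)·log₂(j+1), i.e. 2^(b·|S|) ≤ (j+1)^a.
LogSplitting : ℕ → ℕ → Tree → Set
LogSplitting a b T =
  (S : List (Pos T)) → IsSlice S → 2 ^ (b * length S) ≤ (sliceLeaves S + 1) ^ a

module Submission where

-- The marked nodes form a binary tree whose k leaves are the marked leaves; each of its
-- m − (2k − 1) nodes with a single marked child contributes one maximal unmarked subtree.
-- Cut at the marked leaves, these unmarked subtrees fall into k + 1 slices of T, with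
-- j₀ + … + j_k = n − k leaves in total.  Log-splitting bounds the number of subtrees in
-- slice i by c·log(jᵢ + 1), and AM-GM bounds ∏ (jᵢ + 1) by ((n + 1)/(k + 1))^(k + 1),
-- which is at most (n/k)^(k + 1) since k ≤ n.

open import Defs
import Algebra.Properties.CommutativeSemigroup
import Algebra.Solver.Monoid as MonoidSolver
open import Data.Bool using (true; false)
open import Data.Bool.Properties using (∨-conicalˡ; ∨-conicalʳ; ∨-zeroʳ)
open import Data.Empty using (⊥; ⊥-elim)
open import Data.List using (List; []; _∷_; _++_; map; length; concat)
open import Data.List.Properties
  using (++-monoid; ++-identityʳ; map-++; map-∘; concat-map; concat-++; length-++; length-map)
open import Data.List.Relation.Unary.All using (All; []; _∷_; universal)
import Data.List.Relation.Unary.All as All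
import Data.List.Relation.Unary.All.Properties as Allₚ
open import Data.List.Relation.Unary.AllPairs using (AllPairs; []; _∷_)
import Data.List.Relation.Unary.AllPairs as AllPairs
import Data.List.Relation.Unary.AllPairs.Properties as AllPairsₚ
open import Data.List.Relation.Unary.Any using (here; satisfied)
import Data.List.Relation.Unary.Any as Any
import Data.List.Relation.Unary.Any.Properties as Anyₚ
open import Data.Nat using (ℕ; zero; suc; z≤n; _+_; _*_; _∸_; _^_; _≤_; _<_; _<?_; NonZero; ≢-nonZero)
open import Data.Nat.ListAction using (sum; product)
open import Data.Nat.ListAction.Properties using (sum-++)
open import Data.Nat.Properties
open import Data.Nat.Tactic.RingSolver using (solve-∀)
open import Data.Product using (_×_; _,_; proj₁; proj₂; ∃-syntax)
open import Data.Sum using (_⊎_; inj₁; inj₂)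
open import Data.Unit using (⊤; tt)
open import Relation.Binary.PropositionalEquality
open import Relation.Nullary using (¬_; yes; no)

open Algebra.Properties.CommutativeSemigroup +-commutativeSemigroup using ()
  renaming (interchange to +-interchange)
open Algebra.Properties.CommutativeSemigroup *-commutativeSemigroup using ()
  renaming (interchange to *-interchange)

private
  variable
    t l r : Tree
    i j lo hi : ℕ

^-distrib-* : ∀ m n o → (m * n) ^ o ≡ m ^ o * n ^ o
^-distrib-* m n zero    = refl
^-distrib-* m n (suc o) = trans (cong (m * n *_) (^-distrib-* m n o)) (*-interchange m n (m ^ o) (n ^ o))

*-+-rearrangement : ∀ {a b c d} → a ≤ b → c ≤ d → a * d + b * c ≤ a * c + b * d
*-+-rearrangement {a} {b} {c} {d} a≤b c≤d =
  subst₂ (λ b d → a * d + b * c ≤ a * c + b * d) (m+[n∸m]≡n a≤b) (m+[n∸m]≡n c≤d)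
    (≤-trans (m≤m+n _ ((b ∸ a) * (d ∸ c))) (≤-reflexive (expand a (b ∸ a) c (d ∸ c))))
  where
  expand : ∀ a e c f → a * (c + f) + (a + e) * c + e * f ≡ a * c + (a + e) * (c + f)
  expand = solve-∀

rearrangement-^ : ∀ u v m → u * v ^ m + v * u ^ m ≤ u * u ^ m + v * v ^ m
rearrangement-^ u v m with ≤-total u v
... | inj₁ u≤v = *-+-rearrangement u≤v (^-monoˡ-≤ m u≤v)
... | inj₂ v≤u = subst₂ _≤_ (+-comm (v * u ^ m) (u * v ^ m)) (+-comm (v * v ^ m) (u * u ^ m))
                        (*-+-rearrangement v≤u (^-monoˡ-≤ m v≤u))

weighted-amgm : ∀ m u v → suc m * u * v ^ m ≤ u ^ suc m + m * v ^ suc m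
weighted-amgm zero    u v = ≤-reflexive (solve u)
  where
  solve : ∀ u → 1 * u * 1 ≡ u * 1 + 0
  solve = solve-∀
weighted-amgm (suc m) u v = begin
  suc (suc m) * u * (v * V)                 ≡⟨ split m u v V ⟩
  u * (v * V) + (suc m * u * V) * v         ≤⟨ +-monoʳ-≤ (u * (v * V)) (*-monoˡ-≤ v (weighted-amgm m u v)) ⟩
  u * (v * V) + (U + m * (v * V)) * v       ≡⟨ regroup m u v V U ⟩
  (u * (v * V) + v * U) + m * (v * (v * V)) ≤⟨ +-monoˡ-≤ (m * (v * (v * V))) (rearrangement-^ u v (suc m)) ⟩
  (u * U + v * (v * V)) + m * (v * (v * V)) ≡⟨ collect m u v V U ⟩
  u * U + suc m * (v * (v * V))             ∎
  where
  open ≤-Reasoning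
  V = v ^ m
  U = u ^ suc m
  split : ∀ m u v V → suc (suc m) * u * (v * V) ≡ u * (v * V) + (suc m * u * V) * v
  split = solve-∀
  regroup : ∀ m u v V U → u * (v * V) + (U + m * (v * V)) * v ≡ (u * (v * V) + v * U) + m * (v * (v * V))
  regroup = solve-∀
  collect : ∀ m u v V U → (u * U + v * (v * V)) + m * (v * (v * V)) ≡ u * U + suc m * (v * (v * V))
  collect = solve-∀

-- Weighted AM-GM for u = L(x + S) and v = (L + 1)S; the term L·(L + 1)^(L + 1)·S^(L + 1)
-- occurs on both sides and cancels.
amgm-key : ∀ L .{{_ : NonZero L}} x S → suc L ^ suc L * x * S ^ L ≤ L ^ L * (x + S) ^ suc L
amgm-key L x S = *-cancelˡ-≤ L (+-cancelʳ-≤ (L * (v * (A * B))) _ _ (begin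
  L * (suc L ^ suc L * x * S ^ L) + L * (v * (A * B))   ≡⟨ expand L x S A B ⟩
  suc L * u * (A * B)                                 ≡⟨ cong (suc L * u *_) (^-distrib-* (suc L) S L) ⟨
  suc L * u * v ^ L                                   ≤⟨ weighted-amgm L u v ⟩
  u ^ suc L + L * (v * v ^ L)                         ≡⟨ cong₂ (λ p q → p + L * (v * q))
                                                               (^-distrib-* L (x + S) (suc L)) (^-distrib-* (suc L) S L) ⟩
  L * L ^ L * (x + S) ^ suc L + L * (v * (A * B))      ≡⟨ cong (_+ L * (v * (A * B))) (*-assoc L (L ^ L) _) ⟩
  L * (L ^ L * (x + S) ^ suc L) + L * (v * (A * B))    ∎))
  where
  open ≤-Reasoning
  u = L * (x + S)
  v = suc L * S
  A = suc L ^ L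
  B = S ^ L
  expand : ∀ L x S A B → L * (suc L * A * x * B) + L * (suc L * S * (A * B)) ≡ suc L * (L * (x + S)) * (A * B)
  expand = solve-∀

amgm-cons : ∀ x P S L .{{_ : NonZero L}} → P * L ^ L ≤ S ^ L → x * P * suc L ^ suc L ≤ (x + S) ^ suc L
amgm-cons x P S L ih = *-cancelʳ-≤ _ _ W {{m^n≢0 L L}} (begin
  x * P * C * W          ≡⟨ reorder x P C W ⟩
  C * x * (P * W)        ≤⟨ *-monoʳ-≤ (C * x) ih ⟩
  C * x * S ^ L          ≤⟨ amgm-key L x S ⟩
  W * (x + S) ^ suc L    ≡⟨ *-comm W _ ⟩
  (x + S) ^ suc L * W    ∎)
  where
  open ≤-Reasoning
  C = suc L ^ suc L
  W = L ^ L
  reorder : ∀ x P C W → x * P * C * W ≡ C * x * (P * W)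
  reorder = solve-∀

amgm : ∀ xs → product xs * length xs ^ length xs ≤ sum xs ^ length xs
amgm []           = ≤-refl
amgm (x ∷ [])     = ≤-reflexive (singleton x)
  where
  singleton : ∀ x → x * 1 * (1 * 1) ≡ (x + 0) * 1
  singleton = solve-∀
amgm (x ∷ y ∷ ys) = amgm-cons x (product (y ∷ ys)) (sum (y ∷ ys)) (length (y ∷ ys)) (amgm (y ∷ ys))

amgm-shift : ∀ {P k n} e → k ≤ n → P * (k + 1) ^ e ≤ (n + 1) ^ e → P * k ^ e ≤ n ^ e
amgm-shift {P} {k} {n} e k≤n bound =
  *-cancelʳ-≤ _ _ ((k + 1) ^ e) {{m^n≢0 (k + 1) e {{≢-nonZero (m+1+n≢0 k)}}}} (begin
    P * k ^ e * (k + 1) ^ e  ≡⟨ swap P (k ^ e) ((k + 1) ^ e) ⟩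
    P * (k + 1) ^ e * k ^ e  ≤⟨ *-monoˡ-≤ (k ^ e) bound ⟩
    (n + 1) ^ e * k ^ e      ≡⟨ ^-distrib-* (n + 1) k e ⟨
    ((n + 1) * k) ^ e        ≤⟨ ^-monoˡ-≤ e cross ⟩
    (n * (k + 1)) ^ e        ≡⟨ ^-distrib-* n (k + 1) e ⟩
    n ^ e * (k + 1) ^ e      ∎)
  where
  open ≤-Reasoning
  swap : ∀ a b c → a * b * c ≡ a * c * b
  swap = solve-∀
  left-form : ∀ n k → (n + 1) * k ≡ n * k + k
  left-form = solve-∀
  right-form : ∀ n k → n * (k + 1) ≡ n * k + n
  right-form = solve-∀
  cross : (n + 1) * k ≤ n * (k + 1)
  cross = subst₂ _≤_ (sym (left-form n k)) (sym (right-form n k)) (+-monoʳ-≤ (n * k) k≤n)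

^-*-bound : ∀ {x P y z} a e → x ≤ P ^ a → P * y ^ e ≤ z ^ e → x * y ^ (a * e) ≤ z ^ (a * e)
^-*-bound {x} {P} {y} {z} a e x≤Pᵃ bound = begin
  x * y ^ (a * e)      ≤⟨ *-mono-≤ x≤Pᵃ (≤-reflexive (^-swap y)) ⟩
  P ^ a * (y ^ e) ^ a  ≡⟨ ^-distrib-* P (y ^ e) a ⟨
  (P * y ^ e) ^ a      ≤⟨ ^-monoˡ-≤ a bound ⟩
  (z ^ e) ^ a          ≡⟨ ^-swap z ⟨
  z ^ (a * e)          ∎
  where
  open ≤-Reasoning
  ^-swap : ∀ w → w ^ (a * e) ≡ (w ^ e) ^ a
  ^-swap w = trans (cong (w ^_) (*-comm a e)) (sym (^-*-assoc w e a))

Separated : Pos t → Pos t → Set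
Separated p q = Disjoint p q × ¬ Siblings p q

NonRoot : Pos t → Set
NonRoot here      = ⊥
NonRoot (left _)  = ⊤
NonRoot (right _) = ⊤

-- Siblings only computes once the constructor of its first argument is known, hence the split.
siblings-left⁻ : (p q : Pos l) → Siblings (left {r = r} p) (left q) → Siblings p q
siblings-left⁻ here      _ s = s
siblings-left⁻ (left _)  _ s = s
siblings-left⁻ (right _) _ s = s

siblings-right⁻ : (p q : Pos r) → Siblings (right {l = l} p) (right q) → Siblings p q
siblings-right⁻ here      _ s = s
siblings-right⁻ (left _)  _ s = s
siblings-right⁻ (right _) _ s = s

¬siblings-left-right : (p : Pos l) (q : Pos r) → NonRoot p ⊎ NonRoot q →
                       ¬ Siblings (left p) (right q)
¬siblings-left-right here      here      (inj₁ ())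
¬siblings-left-right here      here      (inj₂ ())
¬siblings-left-right (left _)  _         _ ()
¬siblings-left-right (right _) _         _ ()
¬siblings-left-right here      (left _)  _ ()
¬siblings-left-right here      (right _) _ ()

separated-left : (p q : Pos l) → Separated p q → Separated (left {r = r} p) (left q)
separated-left p q (d , ¬s) = d , λ s → ¬s (siblings-left⁻ p q s)

separated-right : (p q : Pos r) → Separated p q → Separated (right {l = l} p) (right q)
separated-right p q (d , ¬s) = d , λ s → ¬s (siblings-right⁻ p q s)

separated-left-right : (p : Pos l) (q : Pos r) → NonRoot p ⊎ NonRoot q →
                       Separated (left p) (right q)
separated-left-right p q h = tt , ¬siblings-left-right p q h

leafOf-right⁺ : ∀ {l r j} {p : Pos r} → LeafOf p j → LeafOf (right {l = l} p) (leaves l + j)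
leafOf-right⁺ {l} {j = j} {p} (s≤j , j<e) =
  +-monoʳ-≤ (leaves l) s≤j ,
  subst (leaves l + j <_) (sym (+-assoc (leaves l) (start p) (size p))) (+-monoʳ-< (leaves l) j<e)

leafOf-right⁻ : ∀ {l r j} {p : Pos r} → LeafOf (right {l = l} p) (leaves l + j) → LeafOf p j
leafOf-right⁻ {l} {j = j} {p} (s≤j , j<e) =
  +-cancelˡ-≤ (leaves l) _ _ s≤j ,
  +-cancelˡ-< (leaves l) _ _ (subst (leaves l + j <_) (+-assoc (leaves l) (start p) (size p)) j<e)

leafOf-right-offset : ∀ {l r i} {p : Pos r} → LeafOf (right {l = l} p) i → leaves l ≤ i
leafOf-right-offset {l} {p = p} (s≤i , _) = ≤-trans (m≤m+n (leaves l) (start p)) s≤i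

record Spans (S : List (Pos t)) (lo hi : ℕ) : Set where
  field
    lo≤hi     : lo ≤ hi
    separated : AllPairs Separated S
    inside    : InSlice S i → lo ≤ i × i < hi
    covers    : lo ≤ i → i < hi → InSlice S i
open Spans

spans⇒isSlice : {S : List (Pos t)} → Spans S lo hi → IsSlice S
spans⇒isSlice s = separated s , λ x y z x≤y y≤z x∈S z∈S →
  covers s (≤-trans (proj₁ (inside s x∈S)) x≤y) (≤-<-trans y≤z (proj₂ (inside s z∈S)))

spans-[] : Spans {t = t} [] lo lo
spans-[] = record
  { lo≤hi = ≤-refl ; separated = [] ; inside = λ () ; covers = λ lo≤i i<lo → ⊥-elim (<⇒≱ i<lo lo≤i) }

spans-root : Spans {t = t} (here ∷ []) 0 (leaves t)
spans-root = record
  { lo≤hi     = z≤n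
  ; separated = [] ∷ []
  ; inside    = λ { (here (_ , i<n)) → z≤n , i<n }
  ; covers    = λ _ i<n → here (z≤n , i<n) }

spans-left : {S : List (Pos l)} → Spans S lo hi → Spans (map (left {r = r}) S) lo hi
spans-left s = record
  { lo≤hi     = lo≤hi s
  ; separated = AllPairsₚ.map⁺ (AllPairs.map (λ {p} {q} → separated-left p q) (separated s))
  ; inside    = λ i∈S → inside s (Anyₚ.map⁻ i∈S)
  ; covers    = λ lo≤i i<hi → Anyₚ.map⁺ (covers s lo≤i i<hi) }

spans-right : {S : List (Pos r)} → Spans S lo hi →
              Spans (map (right {l = l}) S) (leaves l + lo) (leaves l + hi)
spans-right {lo = lo} {hi = hi} {l = l} {S = S} s = record
  { lo≤hi     = +-monoʳ-≤ (leaves l) (lo≤hi s)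
  ; separated = AllPairsₚ.map⁺ (AllPairs.map (λ {p} {q} → separated-right p q) (separated s))
  ; inside    = inside′
  ; covers    = covers′ }
  where
  L = leaves l
  offset : InSlice (map (right {l = l}) S) i → ∃[ j ] L + j ≡ i
  offset i∈S = let p , i∈p = satisfied (Anyₚ.map⁻ i∈S)
                in m≤n⇒∃[o]m+o≡n (leafOf-right-offset {l} {p = p} i∈p)
  inside′ : InSlice (map right S) i → L + lo ≤ i × i < L + hi
  inside′ i∈S with offset i∈S
  ... | j , refl with inside s (Any.map (λ {p} → leafOf-right⁻ {l} {p = p}) (Anyₚ.map⁻ i∈S))
  ... | lo≤j , j<hi = +-monoʳ-≤ L lo≤j , +-monoʳ-< L j<hi
  covers′ : L + lo ≤ i → i < L + hi → InSlice (map right S) i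
  covers′ L+lo≤i i<L+hi with m≤n⇒∃[o]m+o≡n (≤-trans (m≤m+n L lo) L+lo≤i)
  ... | j , refl = Anyₚ.map⁺ (Any.map (λ {p} → leafOf-right⁺ {l} {p = p})
                     (covers s (+-cancelˡ-≤ L _ _ L+lo≤i) (+-cancelˡ-< L _ _ i<L+hi)))

spans-++ : {S S′ : List (Pos t)} → Spans S lo i → Spans S′ i hi →
           All (λ p → All (Separated p) S′) S → Spans (S ++ S′) lo hi
spans-++ {lo = lo} {i = b} {hi = hi} {S = S} {S′ = S′} s s′ cross = record
  { lo≤hi     = ≤-trans (lo≤hi s) (lo≤hi s′)
  ; separated = AllPairsₚ.++⁺ (separated s) (separated s′) cross
  ; inside    = inside′
  ; covers    = covers′ }
  where
  inside′ : InSlice (S ++ S′) j → lo ≤ j × j < hi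
  inside′ j∈ with Anyₚ.++⁻ S j∈
  ... | inj₁ j∈S  = proj₁ (inside s j∈S) , <-≤-trans (proj₂ (inside s j∈S)) (lo≤hi s′)
  ... | inj₂ j∈S′ = ≤-trans (lo≤hi s) (proj₁ (inside s′ j∈S′)) , proj₂ (inside s′ j∈S′)
  covers′ : lo ≤ j → j < hi → InSlice (S ++ S′) j
  covers′ {j} lo≤j j<hi with j <? b
  ... | yes j<b = Anyₚ.++⁺ˡ (covers s lo≤j j<b)
  ... | no  j≮b = Anyₚ.++⁺ʳ S (covers s′ (≮⇒≥ j≮b) j<hi)

spans-right₀ : {S : List (Pos r)} → Spans S 0 hi → Spans (map (right {l = l}) S) (leaves l) (leaves l + hi)
spans-right₀ {hi = hi} {l = l} {S = S} s =
  subst (λ lo → Spans (map (right {l = l}) S) lo (leaves l + hi)) (+-identityʳ (leaves l)) (spans-right {l = l} s)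

Spanning : List (Pos t) → Set
Spanning S = ∃[ lo ] ∃[ hi ] Spans S lo hi

spanning-left : {S : List (Pos l)} → Spanning S → Spanning (map (left {r = r}) S)
spanning-left (lo , hi , s) = lo , hi , spans-left s

spanning-right : {S : List (Pos r)} → Spanning S → Spanning (map (right {l = l}) S)
spanning-right {l = l} (lo , hi , s) = leaves l + lo , leaves l + hi , spans-right s

nonRoot-left : (S : List (Pos l)) → All NonRoot (map (left {r = r}) S)
nonRoot-left S = Allₚ.map⁺ (universal (λ _ → tt) S)

nonRoot-right : (S : List (Pos r)) → All NonRoot (map (right {l = l}) S)
nonRoot-right S = Allₚ.map⁺ (universal (λ _ → tt) S)

separated-lefts-rights : (S : List (Pos l)) (S′ : List (Pos r)) → All NonRoot S ⊎ All NonRoot S′ →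
                         All (λ p → All (Separated p) (map right S′)) (map left S)
separated-lefts-rights S S′ (inj₁ nS) =
  Allₚ.map⁺ (All.map (λ {p} np →
    Allₚ.map⁺ (universal (λ q → separated-left-right p q (inj₁ np)) S′)) nS)
separated-lefts-rights S S′ (inj₂ nS′) =
  Allₚ.map⁺ (universal (λ p →
    Allₚ.map⁺ (All.map (λ {q} nq → separated-left-right p q (inj₂ nq)) nS′)) S)

-- The maximal unmarked subtrees of T, grouped by the gaps between consecutive marked leaves:
-- first lies before the first marked leaf, middle has one slice per pair of consecutive marked
-- leaves, last lies after the last marked leaf.  Since no root in first or last is the root of T,
-- gluing the last slice of one subtree to the first slice of its sibling creates no siblings.
record Gaps (T : Tree) : Set where
  field
    first         : List (Pos T)
    middle        : List (List (Pos T))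
    last          : List (Pos T)
    first-spans   : ∃[ f ] Spans first 0 f
    middle-spans  : All Spanning middle
    last-spans    : ∃[ g ] Spans last g (leaves T)
    first-nonRoot : All NonRoot first
    last-nonRoot  : All NonRoot last

  slices : List (List (Pos T))
  slices = first ∷ middle ++ last ∷ []

  hangingRoots : List (Pos T)
  hangingRoots = first ++ concat middle ++ last
open Gaps

leafGaps : Gaps (leaf true)
leafGaps = record
  { first = [] ; middle = [] ; last = []
  ; first-spans = 0 , spans-[] ; middle-spans = [] ; last-spans = 1 , spans-[]
  ; first-nonRoot = [] ; last-nonRoot = [] }

joinGaps : Gaps l → Gaps r → Gaps (node l r)
joinGaps {l = l} Gl Gr = record
  { first         = map left (first Gl)
  ; middle        = map (map left) (middle Gl) ++ gap ∷ map (map right) (middle Gr)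
  ; last          = map right (last Gr)
  ; first-spans   = let f , s = first-spans Gl in f , spans-left s
  ; middle-spans  = Allₚ.++⁺ (Allₚ.map⁺ (All.map spanning-left (middle-spans Gl)))
                             (gap-spanning ∷ Allₚ.map⁺ (All.map (spanning-right {l = l}) (middle-spans Gr)))
  ; last-spans    = let g , s = last-spans Gr in leaves l + g , spans-right s
  ; first-nonRoot = nonRoot-left (first Gl)
  ; last-nonRoot  = nonRoot-right (last Gr) }
  where
  gap = map left (last Gl) ++ map right (first Gr)
  gap-spanning : Spanning gap
  gap-spanning =
    let g , sl = last-spans Gl
        f , sr = first-spans Gr
    in g , leaves l + f ,
       spans-++ (spans-left sl) (spans-right₀ sr)
                (separated-lefts-rights (last Gl) (first Gr) (inj₁ (last-nonRoot Gl)))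

withUnmarkedRight : Gaps l → Gaps (node l r)
withUnmarkedRight Gl = record
  { first         = map left (first Gl)
  ; middle        = map (map left) (middle Gl)
  ; last          = map left (last Gl) ++ right here ∷ []
  ; first-spans   = let f , s = first-spans Gl in f , spans-left s
  ; middle-spans  = Allₚ.map⁺ (All.map spanning-left (middle-spans Gl))
  ; last-spans    = let g , s = last-spans Gl in
                    g , spans-++ (spans-left s) (spans-right₀ spans-root)
                                 (separated-lefts-rights (last Gl) (here ∷ []) (inj₁ (last-nonRoot Gl)))
  ; first-nonRoot = nonRoot-left (first Gl)
  ; last-nonRoot  = Allₚ.++⁺ (nonRoot-left (last Gl)) (tt ∷ []) }

withUnmarkedLeft : Gaps r → Gaps (node l r)
withUnmarkedLeft {l = l} Gr = record
  { first         = left here ∷ map right (first Gr)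
  ; middle        = map (map right) (middle Gr)
  ; last          = map right (last Gr)
  ; first-spans   = let f , s = first-spans Gr in
                    leaves l + f , spans-++ (spans-left spans-root) (spans-right₀ s)
                                            (separated-lefts-rights (here ∷ []) (first Gr) (inj₂ (first-nonRoot Gr)))
  ; middle-spans  = Allₚ.map⁺ (All.map (spanning-right {l = l}) (middle-spans Gr))
  ; last-spans    = let g , s = last-spans Gr in leaves l + g , spans-right s
  ; first-nonRoot = tt ∷ nonRoot-right (first Gr)
  ; last-nonRoot  = nonRoot-right (last Gr) }

map-++-++ : ∀ {A B : Set} (f : A → B) xs ys zs → map f (xs ++ ys ++ zs) ≡ map f xs ++ map f ys ++ map f zs
map-++-++ f xs ys zs = trans (map-++ f xs (ys ++ zs)) (cong (map f xs ++_) (map-++ f ys zs))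

hangingRoots-join : (Gl : Gaps l) (Gr : Gaps r) →
  hangingRoots (joinGaps Gl Gr) ≡ map left (hangingRoots Gl) ++ map right (hangingRoots Gr)
hangingRoots-join {l = l} {r = r} Gl Gr = begin
  map left Fl ++ concat (map (map left) Ml ++ (map left Ll ++ map right Fr) ∷ map (map right) Mr)
    ++ map right Lr
    ≡⟨ cong (λ X → map left Fl ++ X ++ map right Lr) concat-middle ⟩
  map left Fl ++ (map left (concat Ml) ++ (map left Ll ++ map right Fr) ++ map right (concat Mr))
    ++ map right Lr
    ≡⟨ regroup (map left Fl) (map left (concat Ml)) (map left Ll)
               (map right Fr) (map right (concat Mr)) (map right Lr) ⟩
  (map left Fl ++ map left (concat Ml) ++ map left Ll) ++
    map right Fr ++ map right (concat Mr) ++ map right Lr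
    ≡⟨ sym (cong₂ _++_ (map-++-++ left Fl (concat Ml) Ll) (map-++-++ right Fr (concat Mr) Lr)) ⟩
  map left (Fl ++ concat Ml ++ Ll) ++ map right (Fr ++ concat Mr ++ Lr) ∎
  where
  open ≡-Reasoning
  open MonoidSolver (++-monoid (Pos (node l r)))
  Fl = first Gl ; Ml = middle Gl ; Ll = last Gl
  Fr = first Gr ; Mr = middle Gr ; Lr = last Gr
  concat-middle : concat (map (map left) Ml ++ (map left Ll ++ map right Fr) ∷ map (map right) Mr)
                  ≡ map left (concat Ml) ++ (map left Ll ++ map right Fr) ++ map right (concat Mr)
  concat-middle = trans (sym (concat-++ (map (map left) Ml) _))
                        (cong₂ (λ A B → A ++ (map left Ll ++ map right Fr) ++ B) (concat-map Ml) (concat-map Mr))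
  regroup : (a b c d e f : List (Pos (node l r))) →
            a ++ (b ++ (c ++ d) ++ e) ++ f ≡ (a ++ b ++ c) ++ d ++ e ++ f
  regroup = solve 6 (λ a b c d e f →
    a ⊕ ((b ⊕ ((c ⊕ d) ⊕ e)) ⊕ f) ⊜ (a ⊕ (b ⊕ c)) ⊕ (d ⊕ (e ⊕ f))) refl

hangingRoots-withUnmarkedRight : (Gl : Gaps l) →
  hangingRoots (withUnmarkedRight {r = r} Gl) ≡ map left (hangingRoots Gl) ++ right here ∷ []
hangingRoots-withUnmarkedRight {l = l} {r = r} Gl = begin
  map left Fl ++ concat (map (map left) Ml) ++ map left Ll ++ right here ∷ []
    ≡⟨ cong (λ X → map left Fl ++ X ++ map left Ll ++ right here ∷ []) (concat-map Ml) ⟩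
  map left Fl ++ map left (concat Ml) ++ map left Ll ++ right here ∷ []
    ≡⟨ regroup (map left Fl) (map left (concat Ml)) (map left Ll) (right here ∷ []) ⟩
  (map left Fl ++ map left (concat Ml) ++ map left Ll) ++ right here ∷ []
    ≡⟨ cong (_++ right here ∷ []) (sym (map-++-++ left Fl (concat Ml) Ll)) ⟩
  map left (Fl ++ concat Ml ++ Ll) ++ right here ∷ [] ∎
  where
  open ≡-Reasoning
  open MonoidSolver (++-monoid (Pos (node l r)))
  Fl = first Gl ; Ml = middle Gl ; Ll = last Gl
  regroup : (a b c d : List (Pos (node l r))) → a ++ b ++ c ++ d ≡ (a ++ b ++ c) ++ d
  regroup = solve 4 (λ a b c d → a ⊕ (b ⊕ (c ⊕ d)) ⊜ (a ⊕ (b ⊕ c)) ⊕ d) refl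

hangingRoots-withUnmarkedLeft : (Gr : Gaps r) →
  hangingRoots (withUnmarkedLeft {l = l} Gr) ≡ left here ∷ map right (hangingRoots Gr)
hangingRoots-withUnmarkedLeft Gr = cong (left here ∷_) (begin
  map right Fr ++ concat (map (map right) Mr) ++ map right Lr
    ≡⟨ cong (λ X → map right Fr ++ X ++ map right Lr) (concat-map Mr) ⟩
  map right Fr ++ map right (concat Mr) ++ map right Lr
    ≡⟨ sym (map-++-++ right Fr (concat Mr) Lr) ⟩
  map right (Fr ++ concat Mr ++ Lr) ∎)
  where
  open ≡-Reasoning
  Fr = first Gr ; Mr = middle Gr ; Lr = last Gr

sliceLeaves-++ : (S S′ : List (Pos t)) → sliceLeaves (S ++ S′) ≡ sliceLeaves S + sliceLeaves S′
sliceLeaves-++ S S′ = trans (cong sum (map-++ size S S′)) (sum-++ (map size S) (map size S′))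

sliceLeaves-left : (S : List (Pos l)) → sliceLeaves (map (left {r = r}) S) ≡ sliceLeaves S
sliceLeaves-left S = cong sum (sym (map-∘ S))

sliceLeaves-right : (S : List (Pos r)) → sliceLeaves (map (right {l = l}) S) ≡ sliceLeaves S
sliceLeaves-right S = cong sum (sym (map-∘ S))

sliceLeaves-left-right : (S : List (Pos l)) (S′ : List (Pos r)) →
  sliceLeaves (map left S ++ map right S′) ≡ sliceLeaves S + sliceLeaves S′
sliceLeaves-left-right S S′ = trans (sliceLeaves-++ (map left S) (map right S′))
                                    (cong₂ _+_ (sliceLeaves-left S) (sliceLeaves-right S′))

length-left-right : (S : List (Pos l)) (S′ : List (Pos r)) →
  length (map left S ++ map right S′) ≡ length S + length S′
length-left-right S S′ = trans (length-++ (map left S)) (cong₂ _+_ (length-map left S) (length-map right S′))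

markedLeaves-unmarked : (t : Tree) → hasMark t ≡ false → markedLeaves t ≡ 0
markedLeaves-unmarked (leaf false) _ = refl
markedLeaves-unmarked (node l r)   e =
  cong₂ _+_ (markedLeaves-unmarked l (∨-conicalˡ (hasMark l) (hasMark r) e))
            (markedLeaves-unmarked r (∨-conicalʳ (hasMark l) (hasMark r) e))

markedNodes-unmarked : (t : Tree) → hasMark t ≡ false → markedNodes t ≡ 0
markedNodes-unmarked (leaf false) _ = refl
markedNodes-unmarked (node l r)   e rewrite e =
  cong₂ _+_ (markedNodes-unmarked l (∨-conicalˡ (hasMark l) (hasMark r) e))
            (markedNodes-unmarked r (∨-conicalʳ (hasMark l) (hasMark r) e))

markedNodes-node : (l r : Tree) → hasMark l ≡ true ⊎ hasMark r ≡ true →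
                   markedNodes (node l r) ≡ suc (markedNodes l + markedNodes r)
markedNodes-node l r (inj₁ el) rewrite el = refl
markedNodes-node l r (inj₂ er) rewrite er | ∨-zeroʳ (hasMark l) = refl

hasMark-true : (t : Tree) → 0 < markedLeaves t → hasMark t ≡ true
hasMark-true t k>0 with hasMark t in e
... | true  = refl
... | false = ⊥-elim (<⇒≢ k>0 (sym (markedLeaves-unmarked t e)))

markedLeaves≤leaves : (t : Tree) → markedLeaves t ≤ leaves t
markedLeaves≤leaves (leaf true)  = ≤-refl
markedLeaves≤leaves (leaf false) = z≤n
markedLeaves≤leaves (node l r)   = +-mono-≤ (markedLeaves≤leaves l) (markedLeaves≤leaves r)

record Decomposition (T : Tree) : Set where
  field
    gaps         : Gaps T
    middle-count : suc (length (middle gaps)) ≡ markedLeaves T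
    leaves-count : sliceLeaves (hangingRoots gaps) + markedLeaves T ≡ leaves T
    nodes-count  : suc (markedNodes T) ≡ 2 * markedLeaves T + length (hangingRoots gaps)
open Decomposition

leafDecomposition : Decomposition (leaf true)
leafDecomposition = record
  { gaps = leafGaps ; middle-count = refl ; leaves-count = refl ; nodes-count = refl }

decomposition-join : hasMark l ≡ true → Decomposition l → Decomposition r → Decomposition (node l r)
decomposition-join {l = l} {r = r} el Dl Dr = record
  { gaps         = G
  ; middle-count = middle-count′
  ; leaves-count = leaves-count′
  ; nodes-count  = nodes-count′ }
  where
  open ≡-Reasoning
  Gl = gaps Dl ; Gr = gaps Dr ; G = joinGaps Gl Gr
  kl = markedLeaves l ; kr = markedLeaves r
  Hl = hangingRoots Gl ; Hr = hangingRoots Gr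
  middle-count′ : suc (length (middle G)) ≡ kl + kr
  middle-count′ = begin
    suc (length (map (map left) (middle Gl) ++ _ ∷ map (map right) (middle Gr)))
      ≡⟨ cong suc (length-++ (map (map left) (middle Gl))) ⟩
    suc (length (map (map left) (middle Gl)) + suc (length (map (map right) (middle Gr))))
      ≡⟨ cong₂ (λ a b → suc a + suc b) (length-map (map left) (middle Gl))
                                        (length-map (map right) (middle Gr)) ⟩
    suc (length (middle Gl)) + suc (length (middle Gr))
      ≡⟨ cong₂ _+_ (middle-count Dl) (middle-count Dr) ⟩
    kl + kr ∎
  leaves-count′ : sliceLeaves (hangingRoots G) + (kl + kr) ≡ leaves l + leaves r
  leaves-count′ = begin
    sliceLeaves (hangingRoots G) + (kl + kr)
      ≡⟨ cong (λ H → sliceLeaves H + (kl + kr)) (hangingRoots-join Gl Gr) ⟩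
    sliceLeaves (map left Hl ++ map right Hr) + (kl + kr)
      ≡⟨ cong (_+ (kl + kr)) (sliceLeaves-left-right Hl Hr) ⟩
    (sliceLeaves Hl + sliceLeaves Hr) + (kl + kr)
      ≡⟨ +-interchange (sliceLeaves Hl) (sliceLeaves Hr) kl kr ⟩
    (sliceLeaves Hl + kl) + (sliceLeaves Hr + kr)
      ≡⟨ cong₂ _+_ (leaves-count Dl) (leaves-count Dr) ⟩
    leaves l + leaves r ∎
  nodes-count′ : suc (markedNodes (node l r)) ≡ 2 * (kl + kr) + length (hangingRoots G)
  nodes-count′ = begin
    suc (markedNodes (node l r))
      ≡⟨ cong suc (markedNodes-node l r (inj₁ el)) ⟩
    suc (suc (markedNodes l + markedNodes r))
      ≡⟨ cong suc (sym (+-suc (markedNodes l) (markedNodes r))) ⟩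
    suc (markedNodes l) + suc (markedNodes r)
      ≡⟨ cong₂ _+_ (nodes-count Dl) (nodes-count Dr) ⟩
    (2 * kl + length Hl) + (2 * kr + length Hr)
      ≡⟨ +-interchange (2 * kl) (length Hl) (2 * kr) (length Hr) ⟩
    (2 * kl + 2 * kr) + (length Hl + length Hr)
      ≡⟨ cong₂ _+_ (sym (*-distribˡ-+ 2 kl kr)) (sym (length-left-right Hl Hr)) ⟩
    2 * (kl + kr) + length (map left Hl ++ map right Hr)
      ≡⟨ cong (λ H → 2 * (kl + kr) + length H) (sym (hangingRoots-join Gl Gr)) ⟩
    2 * (kl + kr) + length (hangingRoots G) ∎

decomposition-withUnmarkedRight : hasMark l ≡ true → hasMark r ≡ false →
                                  Decomposition l → Decomposition (node l r)
decomposition-withUnmarkedRight {l = l} {r = r} el er Dl = record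
  { gaps         = G
  ; middle-count = middle-count′
  ; leaves-count = leaves-count′
  ; nodes-count  = nodes-count′ }
  where
  open ≡-Reasoning
  Gl = gaps Dl ; G = withUnmarkedRight {r = r} Gl
  kl = markedLeaves l ; kr = markedLeaves r ; ml = markedNodes l
  Hl = hangingRoots Gl
  kr≡0 = markedLeaves-unmarked r er
  middle-count′ : suc (length (middle G)) ≡ kl + kr
  middle-count′ = begin
    suc (length (map (map left) (middle Gl))) ≡⟨ cong suc (length-map (map left) (middle Gl)) ⟩
    suc (length (middle Gl))                  ≡⟨ middle-count Dl ⟩
    kl                                        ≡⟨ sym (+-identityʳ kl) ⟩
    kl + 0                                    ≡⟨ cong (kl +_) (sym kr≡0) ⟩
    kl + kr                                   ∎
  leaves-count′ : sliceLeaves (hangingRoots G) + (kl + kr) ≡ leaves l + leaves r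
  leaves-count′ = begin
    sliceLeaves (hangingRoots G) + (kl + kr)
      ≡⟨ cong₂ (λ H k → sliceLeaves H + (kl + k)) (hangingRoots-withUnmarkedRight Gl) kr≡0 ⟩
    sliceLeaves (map left Hl ++ map right (here ∷ [])) + (kl + 0)
      ≡⟨ cong (_+ (kl + 0)) (sliceLeaves-left-right Hl (here ∷ [])) ⟩
    (sliceLeaves Hl + (leaves r + 0)) + (kl + 0)
      ≡⟨ regroup (sliceLeaves Hl) (leaves r) kl ⟩
    (sliceLeaves Hl + kl) + leaves r
      ≡⟨ cong (_+ leaves r) (leaves-count Dl) ⟩
    leaves l + leaves r ∎
    where
    regroup : ∀ h n k → (h + (n + 0)) + (k + 0) ≡ (h + k) + n
    regroup = solve-∀
  nodes-count′ : suc (markedNodes (node l r)) ≡ 2 * (kl + kr) + length (hangingRoots G)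
  nodes-count′ = begin
    suc (markedNodes (node l r))
      ≡⟨ cong suc (markedNodes-node l r (inj₁ el)) ⟩
    suc (suc (ml + markedNodes r))
      ≡⟨ cong (λ m → suc (suc (ml + m))) (markedNodes-unmarked r er) ⟩
    suc (suc (ml + 0))
      ≡⟨ cong suc (+-identityʳ (suc ml)) ⟩
    suc (suc ml)
      ≡⟨ +-comm 1 (suc ml) ⟩
    suc ml + 1
      ≡⟨ cong (_+ 1) (nodes-count Dl) ⟩
    2 * kl + length Hl + 1
      ≡⟨ regroup kl (length Hl) ⟩
    2 * (kl + 0) + (length Hl + 1)
      ≡⟨ cong₂ (λ k n → 2 * (kl + k) + n) (sym kr≡0) (sym (length-left-right Hl (here ∷ []))) ⟩
    2 * (kl + kr) + length (map left Hl ++ map right (here ∷ []))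
      ≡⟨ cong (λ H → 2 * (kl + kr) + length H) (sym (hangingRoots-withUnmarkedRight Gl)) ⟩
    2 * (kl + kr) + length (hangingRoots G) ∎
    where
    regroup : ∀ k h → 2 * k + h + 1 ≡ 2 * (k + 0) + (h + 1)
    regroup = solve-∀

decomposition-withUnmarkedLeft : hasMark l ≡ false → hasMark r ≡ true →
                                 Decomposition r → Decomposition (node l r)
decomposition-withUnmarkedLeft {l = l} {r = r} el er Dr = record
  { gaps         = G
  ; middle-count = middle-count′
  ; leaves-count = leaves-count′
  ; nodes-count  = nodes-count′ }
  where
  open ≡-Reasoning
  Gr = gaps Dr ; G = withUnmarkedLeft {l = l} Gr
  kl = markedLeaves l ; kr = markedLeaves r ; mr = markedNodes r
  Hr = hangingRoots Gr
  kl≡0 = markedLeaves-unmarked l el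
  middle-count′ : suc (length (middle G)) ≡ kl + kr
  middle-count′ = begin
    suc (length (map (map right) (middle Gr))) ≡⟨ cong suc (length-map (map right) (middle Gr)) ⟩
    suc (length (middle Gr))                   ≡⟨ middle-count Dr ⟩
    0 + kr                                     ≡⟨ cong (_+ kr) (sym kl≡0) ⟩
    kl + kr                                    ∎
  leaves-count′ : sliceLeaves (hangingRoots G) + (kl + kr) ≡ leaves l + leaves r
  leaves-count′ = begin
    sliceLeaves (hangingRoots G) + (kl + kr)
      ≡⟨ cong₂ (λ H k → sliceLeaves H + (k + kr)) (hangingRoots-withUnmarkedLeft {l = l} Gr) kl≡0 ⟩
    (leaves l + sliceLeaves (map right Hr)) + kr
      ≡⟨ cong (λ n → leaves l + n + kr) (sliceLeaves-right Hr) ⟩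
    (leaves l + sliceLeaves Hr) + kr
      ≡⟨ +-assoc (leaves l) (sliceLeaves Hr) kr ⟩
    leaves l + (sliceLeaves Hr + kr)
      ≡⟨ cong (leaves l +_) (leaves-count Dr) ⟩
    leaves l + leaves r ∎
  nodes-count′ : suc (markedNodes (node l r)) ≡ 2 * (kl + kr) + length (hangingRoots G)
  nodes-count′ = begin
    suc (markedNodes (node l r))
      ≡⟨ cong suc (markedNodes-node l r (inj₂ er)) ⟩
    suc (suc (markedNodes l + mr))
      ≡⟨ cong (λ m → suc (suc (m + mr))) (markedNodes-unmarked l el) ⟩
    suc (suc mr)
      ≡⟨ cong suc (nodes-count Dr) ⟩
    suc (2 * kr + length Hr)
      ≡⟨ sym (+-suc (2 * kr) (length Hr)) ⟩
    2 * kr + suc (length Hr)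
      ≡⟨ cong₂ (λ k n → 2 * (k + kr) + suc n) (sym kl≡0) (sym (length-map right Hr)) ⟩
    2 * (kl + kr) + length (left here ∷ map right Hr)
      ≡⟨ cong (λ H → 2 * (kl + kr) + length H) (sym (hangingRoots-withUnmarkedLeft {l = l} Gr)) ⟩
    2 * (kl + kr) + length (hangingRoots G) ∎

decompose : (T : Tree) → hasMark T ≡ true → Decomposition T
decompose (leaf true) _ = leafDecomposition
decompose (node l r) e with hasMark l in el | hasMark r in er
... | true  | true  = decomposition-join el (decompose l el) (decompose r er)
... | true  | false = decomposition-withUnmarkedRight el er (decompose l el)
... | false | true  = decomposition-withUnmarkedLeft el er (decompose r er)
decompose (node l r) () | false | false

slices-isSlice : (G : Gaps t) → All IsSlice (slices G)
slices-isSlice G =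
  spans⇒isSlice (proj₂ (first-spans G)) ∷
  Allₚ.++⁺ (All.map (λ (_ , _ , s) → spans⇒isSlice s) (middle-spans G))
           (spans⇒isSlice (proj₂ (last-spans G)) ∷ [])

concat-slices : (G : Gaps t) → concat (slices G) ≡ hangingRoots G
concat-slices G = cong (first G ++_) (begin
  concat (middle G ++ last G ∷ [])      ≡⟨ concat-++ (middle G) (last G ∷ []) ⟨
  concat (middle G) ++ last G ++ []     ≡⟨ cong (concat (middle G) ++_) (++-identityʳ (last G)) ⟩
  concat (middle G) ++ last G           ∎)
  where open ≡-Reasoning

sliceLeaves-concat : (Ss : List (List (Pos t))) → sliceLeaves (concat Ss) ≡ sum (map sliceLeaves Ss)
sliceLeaves-concat []       = refl
sliceLeaves-concat (S ∷ Ss) =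
  trans (sliceLeaves-++ S (concat Ss)) (cong (sliceLeaves S +_) (sliceLeaves-concat Ss))

length-concat : ∀ {A : Set} (xss : List (List A)) → length (concat xss) ≡ sum (map length xss)
length-concat []         = refl
length-concat (xs ∷ xss) = trans (length-++ xs) (cong (length xs +_) (length-concat xss))

sum-map-+1 : ∀ {A : Set} (f : A → ℕ) xs → sum (map (λ x → f x + 1) xs) ≡ sum (map f xs) + length xs
sum-map-+1 f []       = refl
sum-map-+1 f (x ∷ xs) = trans (cong (f x + 1 +_) (sum-map-+1 f xs)) (regroup (f x) (sum (map f xs)) (length xs))
  where
  regroup : ∀ a s n → a + 1 + (s + n) ≡ a + s + suc n
  regroup = solve-∀

logSplitting-product : ∀ {T} a b → LogSplitting a b T → (Ss : List (List (Pos T))) → All IsSlice Ss →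
                       2 ^ (b * sum (map length Ss)) ≤ product (map (λ S → sliceLeaves S + 1) Ss) ^ a
logSplitting-product a b _ [] [] rewrite *-zeroʳ b | ^-zeroˡ a = ≤-refl
logSplitting-product a b splitting (S ∷ Ss) (S-slice ∷ Ss-slices) = begin
  2 ^ (b * (length S + n))                   ≡⟨ cong (2 ^_) (*-distribˡ-+ b (length S) n) ⟩
  2 ^ (b * length S + b * n)                 ≡⟨ ^-distribˡ-+-* 2 (b * length S) (b * n) ⟩
  2 ^ (b * length S) * 2 ^ (b * n)           ≤⟨ *-mono-≤ (splitting S S-slice)
                                                         (logSplitting-product a b splitting Ss Ss-slices) ⟩
  (sliceLeaves S + 1) ^ a * P ^ a            ≡⟨ ^-distrib-* (sliceLeaves S + 1) P a ⟨
  ((sliceLeaves S + 1) * P) ^ a              ∎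
  where
  open ≤-Reasoning
  n = sum (map length Ss)
  P = product (map (λ S → sliceLeaves S + 1) Ss)

weights : Gaps t → List ℕ
weights G = map (λ S → sliceLeaves S + 1) (slices G)

length-slices : (D : Decomposition t) → length (slices (gaps D)) ≡ markedLeaves t + 1
length-slices D = trans (cong suc (length-++ (middle (gaps D)))) (cong (_+ 1) (middle-count D))

length-weights : (D : Decomposition t) → length (weights (gaps D)) ≡ markedLeaves t + 1
length-weights D = trans (length-map _ (slices (gaps D))) (length-slices D)

sum-weights : (D : Decomposition t) → sum (weights (gaps D)) ≡ leaves t + 1
sum-weights {t} D = begin
  sum (weights G)
    ≡⟨ sum-map-+1 sliceLeaves (slices G) ⟩
  sum (map sliceLeaves (slices G)) + length (slices G)
    ≡⟨ cong₂ _+_ sliceLeaves-slices (sym (length-slices D)) ⟨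
  sliceLeaves (hangingRoots G) + (markedLeaves t + 1)
    ≡⟨ +-assoc _ (markedLeaves t) 1 ⟨
  sliceLeaves (hangingRoots G) + markedLeaves t + 1
    ≡⟨ cong (_+ 1) (leaves-count D) ⟩
  leaves t + 1 ∎
  where
  open ≡-Reasoning
  G = gaps D
  sliceLeaves-slices : sliceLeaves (hangingRoots G) ≡ sum (map sliceLeaves (slices G))
  sliceLeaves-slices = trans (cong sliceLeaves (sym (concat-slices G))) (sliceLeaves-concat (slices G))

excess≤subtrees : (D : Decomposition t) →
                  markedNodes t ∸ 2 * markedLeaves t ≤ sum (map length (slices (gaps D)))
excess≤subtrees {t} D = subst (markedNodes t ∸ 2 * markedLeaves t ≤_) length-hanging
  (m≤n+o⇒m∸n≤o (markedNodes t) (2 * markedLeaves t) (≤-trans (n≤1+n _) (≤-reflexive (nodes-count D))))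
  where
  length-hanging : length (hangingRoots (gaps D)) ≡ sum (map length (slices (gaps D)))
  length-hanging = trans (cong length (sym (concat-slices (gaps D)))) (length-concat (slices (gaps D)))

mainTheorem14 : (a b : ℕ) → 0 < a → 0 < b → (T : Tree) → LogSplitting a b T →
    0 < markedLeaves T →
    2 ^ (b * (markedNodes T ∸ 2 * markedLeaves T)) * markedLeaves T ^ (a * (markedLeaves T + 1))
      ≤ leaves T ^ (a * (markedLeaves T + 1))
mainTheorem14 a b _ _ T splitting k>0 =
  ^-*-bound {P = P} a (k + 1) few-marked (amgm-shift {P = P} (k + 1) (markedLeaves≤leaves T) balanced)
  where
  k = markedLeaves T
  D = decompose T (hasMark-true T k>0)
  G = gaps D
  P = product (weights G)
  few-marked : 2 ^ (b * (markedNodes T ∸ 2 * k)) ≤ P ^ a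
  few-marked = ≤-trans (^-monoʳ-≤ 2 (*-monoʳ-≤ b (excess≤subtrees D)))
                       (logSplitting-product a b splitting (slices G) (slices-isSlice G))
  balanced : P * (k + 1) ^ (k + 1) ≤ (leaves T + 1) ^ (k + 1)
  balanced = subst₂ (λ m s → P * m ^ m ≤ s ^ m)
                    (length-weights D) (sum-weights D) (amgm (weights G))
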